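{- Let $A \subseteq \mathbb{R}^d$ be finite, $\sigma = \{0,1,\ldots,s\}$, and $\chi \colon A \to \sigma$ a coloring. Let $\varphi$ be the bijection from the $(s+d)$-cells of $\mathrm{Vor}(\chi)$ to the $d$-cells of $\mathrm{Vor}(A)$ sending the Voronoi domain of $(u_{\chi(a)}, a)$ to the Voronoi domain of $a$. Then the nerve of the $(s+d)$-cells of $\mathrm{Vor}(\chi)$ in $\mathbb{R}^{s+d}$ has a subcomplex that $\varphi$ maps (projects) onto the nerve of the $d$-cells of $\mathrm{Vor}(A)$ in $\mathbb{R}^d$.
   Context: For a finite set $X$ in a Euclidean space, the Voronoi domain of $b \in X$ is the set of points $x$ with $\|x-b\| \le \|x-a\|$ for all $a\in X$, and the Voronoi tessellation $\mathrm{Vor}(X)$ is the collection of these domains. The nerve of a collection of sets is the abstract simplicial complex of all subcollections with non-empty common intersection. Chromatic construction: write $A_j=\chi^{ -1}(j)$; identify $\mathbb{R}^s$ with the hyperplane $x_1+\cdots+x_{s+1}=1$ in $\mathbb{R}^{s+1}$ and let $u_0,\ldots,u_s$ be the vertices of the standard $s$-simplex (the unit coordinate vectors). Set $A' = \bigsqcup_{j}(u_j + A_j) = \{(u_{\chi(a)},a) : a\in A\} \subseteq \mathbb{R}^s\times\mathbb{R}^d = \mathbb{R}^{s+d}$, and $\mathrm{Vor}(\chi) = \mathrm{Vor}(A')$. -}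

module Defs where

open import Data.Nat using (ℕ; zero; suc)
open import Data.Fin using (Fin; zero; suc; _≟_)
open import Data.Fin.Subset using (Subset; _∈_; _⊆_)
open import Data.Product using (Σ; ∃; _×_; _,_)
open import Relation.Nullary using (¬_; yes; no)
open import Relation.Binary.PropositionalEquality using (_≡_)
open import Relation.Binary.Structures using (IsTotalOrder)
open import Algebra.Structures using (IsCommutativeRing)
open import Function.Definitions using (Injective)
open import Function.Bundles using (_⇔_)

record OrderedField : Set₁ where
  infixl 6 _+_
  infixl 7 _*_
  infix 4 _≤_
  field
    Carrier : Set
    _+_ _*_ : Carrier → Carrier → Carrier
    -_      : Carrier → Carrier
    0# 1#   : Carrier
    _≤_     : Carrier → Carrier → Set
    isCommutativeRing : IsCommutativeRing _≡_ _+_ _*_ -_ 0# 1#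
    isTotalOrder      : IsTotalOrder _≡_ _≤_
    0≢1     : ¬ (0# ≡ 1#)
    inverse : ∀ x → ¬ (x ≡ 0#) → Σ Carrier (λ y → x * y ≡ 1#)
    +-mono-≤ : ∀ {x y} z → x ≤ y → x + z ≤ y + z
    *-nonneg : ∀ {x y} → 0# ≤ x → 0# ≤ y → 0# ≤ x * y

module Geometry (F : OrderedField) where
  open OrderedField F

  _-'_ : Carrier → Carrier → Carrier
  x -' y = x + (- y)

  ∑ : ∀ {n} → (Fin n → Carrier) → Carrier
  ∑ {zero}  f = 0#
  ∑ {suc n} f = f zero + ∑ (λ i → f (suc i))

  Point : ℕ → Set
  Point d = Fin d → Carrier

  -- squared Euclidean distance (‖x-a‖ ≤ ‖x-b‖ iff the squares compare likewise)
  sqdist : ∀ {d} → Point d → Point d → Carrier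
  sqdist x a = ∑ (λ k → (x k -' a k) * (x k -' a k))

  VorDom : ∀ {n d} → (Fin n → Point d) → Fin n → Point d → Set
  VorDom X i x = ∀ j → sqdist x (X i) ≤ sqdist x (X j)

  Nerve : ∀ {n d} → (Fin n → Point d) → Subset n → Set
  Nerve X S = ∃ λ x → ∀ i → i ∈ S → VorDom X i x

  -- vertices u_0,…,u_s of the standard s-simplex: unit coordinate vectors of F^(s+1)
  u : ∀ {s} → Fin (suc s) → Point (suc s)
  u j k with j ≟ k
  ... | yes _ = 1#
  ... | no  _ = 0#

  -- ℝ^s is identified with the hyperplane x₁+⋯+x_{s+1} = 1 of ℝ^(s+1);
  -- the ambient space ℝ^(s+d) = ℝ^s × ℝ^d
  LiftedPoint : ℕ → ℕ → Set
  LiftedPoint s d = Σ (Point (suc s)) (λ y → ∑ y ≡ 1#) × Point d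

  sqdistL : ∀ {s d} → LiftedPoint s d → (Point (suc s) × Point d) → Carrier
  sqdistL ((y , _) , x) (v , a) = sqdist y v + sqdist x a

  lift : ∀ {n s d} → (Fin n → Point d) → (Fin n → Fin (suc s)) → Fin n → Point (suc s) × Point d
  lift A χ i = (u (χ i) , A i)

  -- Voronoi domain in Vor(χ) = Vor(A') of the lifted point (u_χ(a_i), a_i)
  VorDomχ : ∀ {n s d} → (Fin n → Point d) → (Fin n → Fin (suc s)) → Fin n → LiftedPoint s d → Set
  VorDomχ A χ i p = ∀ j → sqdistL p (lift A χ i) ≤ sqdistL p (lift A χ j)

  Nerveχ : ∀ {n s d} → (Fin n → Point d) → (Fin n → Fin (suc s)) → Subset n → Set
  Nerveχ {s = s} {d} A χ S = ∃ λ (p : LiftedPoint s d) → ∀ i → i ∈ S → VorDomχ A χ i p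

  -- the bijection φ on cells: domain of (u_χ(a),a) ↦ domain of a; on index subsets
  -- of A it is the identity, so the image of a subcomplex K is K itself.
  φ-image : ∀ {n} → (Subset n → Set) → Subset n → Set
  φ-image K S = K S

  IsSubcomplex : ∀ {n} → (Subset n → Set) → (Subset n → Set) → Set
  IsSubcomplex K N = (∀ S → K S → N S) × (∀ S T → T ⊆ S → K S → K T)

{-# OPTIONS --safe #-}
module Submission where

-- The barycentre of the standard simplex is equidistant from all its vertices u_j.
-- Hence if x lies in the Voronoi domains of the points a_i (i ∈ S) of A, then the
-- lifted point (barycentre, x) has distance ‖x − a_i‖² plus one and the same constant
-- to every lifted site (u_χ(a_i), a_i), so it lies in all the corresponding Voronoi
-- domains of Vor(χ). The nerve of Vor(A) is therefore itself a subcomplex of the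
-- nerve of Vor(χ), and φ maps it onto the nerve of Vor(A).

open import Defs
open import Data.Nat using (ℕ; suc)
open import Data.Fin using (Fin)
open import Data.Fin.Subset using (Subset)
open import Data.Product using (Σ; _×_)
open import Function.Definitions using (Injective)
open import Function.Bundles using (_⇔_)
open import Relation.Binary.PropositionalEquality using (_≡_)

import Data.Fin as Fin
open import Data.Fin.Properties using (suc-injective)
open import Data.Fin.Subset using (_⊆_)
open import Data.Product using (_,_; proj₁; proj₂)
open import Data.Sum using (inj₁; inj₂)
open import Data.Empty using (⊥-elim)
open import Relation.Nullary using (¬_; yes; no)
open import Relation.Binary.PropositionalEquality
  using (refl; sym; trans; cong; cong₂; subst; module ≡-Reasoning)
open import Relation.Binary.Structures using (IsTotalOrder)
open import Algebra.Bundles using (CommutativeRing)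
open import Function.Bundles using (mk⇔)

module OrderedFieldProperties (F : OrderedField) where
  open OrderedField F public

  commutativeRing : CommutativeRing _ _
  commutativeRing = record { isCommutativeRing = isCommutativeRing }

  open CommutativeRing commutativeRing public
    using (+-comm; +-assoc; +-identityˡ; *-identityˡ; -‿inverseʳ; ring; semiring; +-group; +-rawMonoid)
  open import Algebra.Properties.Ring ring using (-1*x≈-x)
  open import Algebra.Properties.Group +-group using (⁻¹-involutive)
  open import Algebra.Definitions.RawMonoid +-rawMonoid public using () renaming (_×_ to _×ₙ_)
  open import Algebra.Properties.Semiring.Mult semiring public using (×-assoc-*)
  open IsTotalOrder isTotalOrder public
    using (total; antisym) renaming (refl to ≤-refl; trans to ≤-trans)

  0≤1 : 0# ≤ 1#
  0≤1 with total 0# 1#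
  ... | inj₁ 0≤1″ = 0≤1″
  ... | inj₂ 1≤0  = ⊥-elim (0≢1 (sym (antisym 1≤0 0≤1′)))
    where
    0≤-1 : 0# ≤ - 1#
    0≤-1 = rearrange (+-mono-≤ (- 1#) 1≤0)
      where
      rearrange : 1# + - 1# ≤ 0# + - 1# → 0# ≤ - 1#
      rearrange h rewrite -‿inverseʳ 1# | +-identityˡ (- 1#) = h
    -1*-1≡1 : - 1# * - 1# ≡ 1#
    -1*-1≡1 = trans (-1*x≈-x (- 1#)) (⁻¹-involutive 1#)
    0≤1′ : 0# ≤ 1#
    0≤1′ = subst (0# ≤_) -1*-1≡1 (*-nonneg 0≤-1 0≤-1)

  x≤x+y : ∀ {x y} → 0# ≤ y → x ≤ x + y
  x≤x+y {x} {y} 0≤y = rearrange (+-mono-≤ x 0≤y)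
    where
    rearrange : 0# + x ≤ y + x → x ≤ x + y
    rearrange h rewrite +-identityˡ x | +-comm y x = h

  ×ₙ-nonneg : ∀ n {x} → 0# ≤ x → 0# ≤ n ×ₙ x
  ×ₙ-nonneg ℕ.zero    0≤x = ≤-refl
  ×ₙ-nonneg (suc n) 0≤x = ≤-trans 0≤x (x≤x+y (×ₙ-nonneg n 0≤x))

  suc×1≢0 : ∀ n → ¬ (suc n ×ₙ 1# ≡ 0#)
  suc×1≢0 n eq = 0≢1 (antisym 0≤1 (subst (1# ≤_) eq (x≤x+y (×ₙ-nonneg n 0≤1))))

  +-monoʳ-≤ : ∀ z {x y} → x ≤ y → z + x ≤ z + y
  +-monoʳ-≤ z {x} {y} x≤y rewrite +-comm z x | +-comm z y = +-mono-≤ z x≤y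

module Barycentre (F : OrderedField) where
  open OrderedFieldProperties F
  open Geometry F
  open ≡-Reasoning

  ∑-const : ∀ {m} (f : Fin m → Carrier) {b} → (∀ k → f k ≡ b) → ∑ f ≡ m ×ₙ b
  ∑-const {ℕ.zero}  f f≡b = refl
  ∑-const {suc m} f f≡b = cong₂ _+_ (f≡b Fin.zero) (∑-const (λ k → f (Fin.suc k)) (λ k → f≡b (Fin.suc k)))

  ∑-const-except : ∀ {m} (f : Fin (suc m) → Carrier) j {b} →
                   (∀ k → ¬ (j ≡ k) → f k ≡ b) → ∑ f ≡ f j + m ×ₙ b
  ∑-const-except f Fin.zero f≡b = cong (f Fin.zero +_) (∑-const _ (λ k → f≡b (Fin.suc k) (λ ())))
  ∑-const-except {suc m} f (Fin.suc j) {b} f≡b = begin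
    f Fin.zero + ∑ (λ k → f (Fin.suc k))  ≡⟨ cong₂ _+_ (f≡b Fin.zero (λ ())) tail ⟩
    b + (f (Fin.suc j) + m ×ₙ b)          ≡⟨ sym (+-assoc b _ _) ⟩
    (b + f (Fin.suc j)) + m ×ₙ b          ≡⟨ cong (_+ m ×ₙ b) (+-comm b _) ⟩
    (f (Fin.suc j) + b) + m ×ₙ b          ≡⟨ +-assoc _ b _ ⟩
    f (Fin.suc j) + suc m ×ₙ b            ∎
    where
    tail : ∑ (λ k → f (Fin.suc k)) ≡ f (Fin.suc j) + m ×ₙ b
    tail = ∑-const-except (λ k → f (Fin.suc k)) j (λ k j≢k → f≡b (Fin.suc k) (λ eq → j≢k (suc-injective eq)))

  u-diagonal : ∀ {s} (j : Fin (suc s)) → u j j ≡ 1#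
  u-diagonal j with j Fin.≟ j
  ... | yes _   = refl
  ... | no j≢j = ⊥-elim (j≢j refl)

  u-offDiagonal : ∀ {s} {j k : Fin (suc s)} → ¬ (j ≡ k) → u j k ≡ 0#
  u-offDiagonal {j = j} {k} j≢k with j Fin.≟ k
  ... | yes j≡k = ⊥-elim (j≢k j≡k)
  ... | no _    = refl

  sqdist-const-u : ∀ {s} c (j : Fin (suc s)) →
                   sqdist (λ _ → c) (u j) ≡ (c -' 1#) * (c -' 1#) + s ×ₙ ((c -' 0#) * (c -' 0#))
  sqdist-const-u c j = trans (∑-const-except _ j (λ k j≢k → cong square (u-offDiagonal j≢k)))
                             (cong (λ v → square v + _) (u-diagonal j))
    where
    square : Carrier → Carrier
    square v = (c -' v) * (c -' v)

  barycentre : ∀ s → Point (suc s)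
  barycentre s _ = proj₁ (inverse (suc s ×ₙ 1#) (suc×1≢0 s))

  ∑-barycentre : ∀ s → ∑ (barycentre s) ≡ 1#
  ∑-barycentre s = begin
    ∑ (barycentre s)               ≡⟨ ∑-const (barycentre s) (λ _ → refl) ⟩
    suc s ×ₙ c                     ≡⟨ cong (suc s ×ₙ_) (sym (*-identityˡ c)) ⟩
    suc s ×ₙ (1# * c)              ≡⟨ sym (×-assoc-* (suc s) 1# c) ⟩
    (suc s ×ₙ 1#) * c              ≡⟨ proj₂ (inverse (suc s ×ₙ 1#) (suc×1≢0 s)) ⟩
    1#                             ∎
    where
    c : Carrier
    c = proj₁ (inverse (suc s ×ₙ 1#) (suc×1≢0 s))

  sqdist-barycentre-u : ∀ {s} (j k : Fin (suc s)) →
                        sqdist (barycentre s) (u j) ≡ sqdist (barycentre s) (u k)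
  sqdist-barycentre-u j k = trans (sqdist-const-u _ j) (sym (sqdist-const-u _ k))

module Lifting (F : OrderedField) where
  open OrderedFieldProperties F
  open Geometry F
  open Barycentre F

  liftToBarycentre : ∀ {s d} → Point d → LiftedPoint s d
  liftToBarycentre {s} x = (barycentre s , ∑-barycentre s) , x

  VorDom⇒VorDomχ : ∀ {n s d} (A : Fin n → Point d) (χ : Fin n → Fin (suc s)) {i x} →
                   VorDom A i x → VorDomχ A χ i (liftToBarycentre x)
  VorDom⇒VorDomχ {s = s} A χ {i} {x} x∈Vi j
    rewrite sqdist-barycentre-u {s} (χ i) (χ j) = +-monoʳ-≤ _ (x∈Vi j)

  Nerve⇒Nerveχ : ∀ {n s d} (A : Fin n → Point d) (χ : Fin n → Fin (suc s)) {S} →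
                 Nerve A S → Nerveχ A χ S
  Nerve⇒Nerveχ A χ (x , x∈V) = liftToBarycentre x , λ i i∈S → VorDom⇒VorDomχ A χ (x∈V i i∈S)

  Nerve-faceClosed : ∀ {n d} (A : Fin n → Point d) S T → T ⊆ S → Nerve A S → Nerve A T
  Nerve-faceClosed A S T T⊆S (x , x∈V) = x , λ i i∈T → x∈V i (T⊆S i∈T)

-- Injectivity of A is what makes φ a bijection on cells; the nerve inclusion does not need it.
mainTheorem2 : (F : OrderedField) → (n d s : ℕ)
    → (A : Fin n → Geometry.Point F d) → Injective _≡_ _≡_ A
    → (χ : Fin n → Fin (suc s))
    → Σ (Subset n → Set) (λ K →
        Geometry.IsSubcomplex F K (Geometry.Nerveχ F A χ)
        × (∀ S → Geometry.φ-image F K S ⇔ Geometry.Nerve F A S))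
mainTheorem2 F n d s A _ χ =
  Nerve A , ((λ S → Nerve⇒Nerveχ A χ) , Nerve-faceClosed A) , λ S → mk⇔ (λ K-S → K-S) (λ N-S → N-S)
  where
  open Geometry F
  open Lifting F
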